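{- Consider the following game. Carole thinks of two integers $A \le B$ in $[0,N]$, and Paul must return some number in $[A,B]$. Paul may ask questions of the form ``Is $x \le A$?'' for any $x \in [0,N]$. If $x \le A$, Carole must answer YES, except that she may lie (answer NO); if $A < x \le B$, she may answer anything (this is not counted as a lie); if $x > B$, she must answer NO. Paul must return his answer after asking at most $Q$ questions, where Carole tells at most $\lceil \rho Q\rceil$ lies, and lies only to questions with $x\le A$. Then for all $\rho < \frac{1}{3}$, Paul has a winning strategy asking $Q = \frac{8 \log N}{(1-3\rho)^2}$ questions. -}

module Defs where

open import Data.Nat using (ℕ; zero; suc; _+_; _*_; _∸_; _≤_; _<_)
open import Data.Nat.DivMod using (_/_)
open import Data.Bool using (Bool; true; false)
open import Data.Product using (_×_)

⌈_/suc_⌉ : ℕ → ℕ → ℕ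
⌈ m /suc d ⌉ = (m + d) / suc d

-- Paul's (deterministic, adaptive) strategy for the game on [0,N] asking at
-- most n questions: either return a number now, or ask "Is x ≤ A ?" for some
-- x ∈ [0,N] and continue according to Carole's YES (true) / NO (false) answer.
data Strategy (N : ℕ) : ℕ → Set where
  answer : ∀ {n} → ℕ → Strategy N n
  ask    : ∀ {n} → (x : ℕ) → x ≤ N → (Bool → Strategy N n) → Strategy N (suc n)

-- Allowed A B x b c : for Carole's secret A ≤ B, answering b to "Is x ≤ A ?"
-- is allowed and costs c lies.
data Allowed (A B x : ℕ) : Bool → ℕ → Set where
  truthful : x ≤ A → Allowed A B x true 0
  lie      : x ≤ A → Allowed A B x false 1
  middle   : A < x → x ≤ B → (b : Bool) → Allowed A B x b 0
  above    : B < x → Allowed A B x false 0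

-- Wins A B L S : against secret (A,B) and any Carole behaviour telling at most
-- L lies (only on questions with x ≤ A), strategy S returns a number in [A,B].
Wins : ∀ {N n} → (A B L : ℕ) → Strategy N n → Set
Wins A B L (answer r)  = A ≤ r × r ≤ B
Wins A B L (ask x _ k) = ∀ b c → Allowed A B x b c → c ≤ L → Wins A B (L ∸ c) (k b)

-- Paul keeps a lower bound lo ≤ B, which he answers at the end, and for every
-- candidate a ∈ (lo, N] the number f a of NO answers to questions x ≤ a, i.e.
-- the lies Carole has told if A = a.  A candidate with e ≤ L such lies weighs
-- 2 ^ (L ∸ e); the potential is the total weight above lo.  A YES to x moves lo
-- to x and a NO halves the weights of all a ≥ x; cutting the weights where the
-- prefix sum crosses a third of the total gives an x after which either answer
-- leaves at most 2/3 of the potential.  Starting from N 2 ^ L, after Q questions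
-- the potential is below N 2 ^ L (2/3) ^ Q < 1, whereas the true A would still
-- carry positive weight if it were above lo, so A ≤ lo ≤ B.  The hypothesis on
-- Q gives (N 2 ^ L) ^ 2 ≤ 2 ^ Q, which yields N 2 ^ L 2 ^ Q < 3 ^ Q since 8 < 9.
module Submission where

open import Data.Bool using (Bool; true; false)
open import Data.Empty using (⊥-elim)
open import Data.Nat using (ℕ; zero; suc; _+_; _*_; _∸_; _^_; _≤_; _<_; z≤n; s≤s; z<s; _≤?_; _<?_; NonZero; >-nonZero)
open import Data.Nat.DivMod using (m/n*n≤m)
open import Data.Nat.Properties
open import Data.Nat.Tactic.RingSolver using (solve-∀)
open import Data.Product using (Σ; ∃-syntax; _,_; _×_)
open import Function using (_∘_)
open import Relation.Binary.PropositionalEquality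
open import Relation.Nullary using (yes; no)
open import Relation.Nullary.Negation using (contradiction)

open import Defs

-- weight L e = 2 ^ (L ∸ e) if e ≤ L, and 0 otherwise.
weight : ℕ → ℕ → ℕ
weight zero    zero    = 1
weight zero    (suc e) = 0
weight (suc L) zero    = 2 * weight L zero
weight (suc L) (suc e) = weight L e

weight-halves : ∀ L e → 2 * weight L (suc e) ≤ weight L e
weight-halves zero    e       = z≤n
weight-halves (suc L) zero    = ≤-refl
weight-halves (suc L) (suc e) = weight-halves L e

weight-pos : ∀ L e → e ≤ L → 0 < weight L e
weight-pos zero    zero    _         = ≤-refl
weight-pos (suc L) zero    _         = ≤-trans (weight-pos L zero z≤n) (m≤m+n _ _)
weight-pos (suc L) (suc e) (s≤s e≤L) = weight-pos L e e≤L

weight-zero : ∀ L → weight L 0 ≡ 2 ^ L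
weight-zero zero    = refl
weight-zero (suc L) = cong (2 *_) (weight-zero L)

sumFrom : (ℕ → ℕ) → ℕ → ℕ → ℕ
sumFrom g s zero    = 0
sumFrom g s (suc n) = g s + sumFrom g (suc s) n

sumFrom-+ : ∀ g s m n → sumFrom g s (m + n) ≡ sumFrom g s m + sumFrom g (s + m) n
sumFrom-+ g s zero    n rewrite +-identityʳ s = refl
sumFrom-+ g s (suc m) n rewrite sumFrom-+ g (suc s) m n | +-suc s m = sym (+-assoc (g s) _ _)

sumFrom-cong : ∀ {g h} s n → (∀ a → a < s + n → g a ≡ h a) → sumFrom g s n ≡ sumFrom h s n
sumFrom-cong s zero    g≡h = refl
sumFrom-cong s (suc n) g≡h = cong₂ _+_ (g≡h s (m<m+n s z<s))
  (sumFrom-cong (suc s) n (λ a a<s+n → g≡h a (≤-trans a<s+n (≤-reflexive (sym (+-suc s n))))))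

*-sumFrom-≤ : ∀ k {g h} s n → (∀ a → s ≤ a → k * h a ≤ g a) → k * sumFrom h s n ≤ sumFrom g s n
*-sumFrom-≤ k s zero    kh≤g = ≤-reflexive (*-zeroʳ k)
*-sumFrom-≤ k s (suc n) kh≤g = ≤-trans (≤-reflexive (*-distribˡ-+ k _ _))
  (+-mono-≤ (kh≤g s ≤-refl) (*-sumFrom-≤ k (suc s) n (λ a s<a → kh≤g a (<⇒≤ s<a))))

term≤sumFrom : ∀ g s {n} i → i < n → g (s + i) ≤ sumFrom g s n
term≤sumFrom g s {suc n} zero    _         rewrite +-identityʳ s = m≤m+n _ _
term≤sumFrom g s {suc n} (suc i) (s≤s i<n) rewrite +-suc s i =
  ≤-trans (term≤sumFrom g (suc s) i i<n) (m≤n+m _ _)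

sumFrom-const : ∀ c s n → sumFrom (λ _ → c) s n ≡ n * c
sumFrom-const c s zero    = refl
sumFrom-const c s (suc n) = cong (c +_) (sumFrom-const c (suc s) n)

intermediate-value : ∀ (F : ℕ → ℕ) n {T} → F 0 ≤ T → T ≤ F (suc n) →
                     ∃[ j ] j ≤ n × F j ≤ T × T ≤ F (suc j)
intermediate-value F zero    F0≤T T≤F1 = 0 , z≤n , F0≤T , T≤F1
intermediate-value F (suc n) F0≤T T≤F with _ ≤? F (suc n)
... | yes T≤Fn = let j , j≤n , Fj≤T , T≤Fj+1 = intermediate-value F n F0≤T T≤Fn
                 in j , m≤n⇒m≤1+n j≤n , Fj≤T , T≤Fj+1
... | no  T≰Fn = suc n , ≤-refl , <⇒≤ (≰⇒> T≰Fn) , T≤F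

dropping-heavy-prefix : ∀ P Y → P + Y ≤ 3 * P → 3 * Y ≤ 2 * (P + Y)
dropping-heavy-prefix P Y Φ≤3P = +-cancelʳ-≤ (P + Y) (3 * Y) (2 * (P + Y)) (begin
  3 * Y + (P + Y)       ≤⟨ +-monoʳ-≤ (3 * Y) Φ≤3P ⟩
  3 * Y + 3 * P         ≡⟨ regroup P Y ⟩
  2 * (P + Y) + (P + Y) ∎)
  where
  open ≤-Reasoning
  regroup : ∀ P Y → 3 * Y + 3 * P ≡ 2 * (P + Y) + (P + Y)
  regroup = solve-∀

halving-heavy-suffix : ∀ P R R′ → 3 * P ≤ P + R → 2 * R′ ≤ R → 3 * (P + R′) ≤ 2 * (P + R)
halving-heavy-suffix P R R′ 3P≤Φ 2R′≤R = *-cancelˡ-≤ 2 (begin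
  2 * (3 * (P + R′))    ≡⟨ regroup₁ P R′ ⟩
  6 * P + 3 * (2 * R′)  ≤⟨ +-monoʳ-≤ (6 * P) (*-monoʳ-≤ 3 2R′≤R) ⟩
  6 * P + 3 * R         ≡⟨ regroup₂ P R ⟩
  3 * P + 3 * (P + R)   ≤⟨ +-monoˡ-≤ (3 * (P + R)) 3P≤Φ ⟩
  (P + R) + 3 * (P + R) ≡⟨ regroup₃ (P + R) ⟩
  2 * (2 * (P + R))     ∎)
  where
  open ≤-Reasoning
  regroup₁ : ∀ P R′ → 2 * (3 * (P + R′)) ≡ 6 * P + 3 * (2 * R′)
  regroup₁ = solve-∀
  regroup₂ : ∀ P R → 6 * P + 3 * R ≡ 3 * P + 3 * (P + R)
  regroup₂ = solve-∀
  regroup₃ : ∀ X → X + 3 * X ≡ 2 * (2 * X)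
  regroup₃ = solve-∀

record TwoThirdsCut (g : ℕ → ℕ) (s n : ℕ) : Set where
  field
    j k            : ℕ
    split          : n ≡ j + suc k
    drop-prefix    : 3 * sumFrom g (suc (s + j)) k ≤ 2 * sumFrom g s n
    halve-suffix   : ∀ h → (∀ a → s + j ≤ a → 2 * h a ≤ g a) →
                     3 * (sumFrom g s j + sumFrom h (s + j) (suc k)) ≤ 2 * sumFrom g s n

two-thirds-cut : ∀ g s m → TwoThirdsCut g s (suc m)
two-thirds-cut g s m
  with intermediate-value (λ i → 3 * sumFrom g s i) m z≤n (m≤n*m (sumFrom g s (suc m)) 3)
... | j , j≤m , 3P≤Φ , Φ≤3P = record
  { j = j ; k = k ; split = split ; drop-prefix = drop-prefix ; halve-suffix = halve-suffix }
  where
  k = m ∸ j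
  split : suc m ≡ j + suc k
  split = trans (cong suc (sym (m+[n∸m]≡n j≤m))) (sym (+-suc j k))

  Φ-split-after-j : sumFrom g s (suc m) ≡ sumFrom g s (suc j) + sumFrom g (suc (s + j)) k
  Φ-split-after-j = begin
    sumFrom g s (suc m)                                ≡⟨ cong (sumFrom g s) split ⟩
    sumFrom g s (j + suc k)                            ≡⟨ cong (sumFrom g s) (+-suc j k) ⟩
    sumFrom g s (suc j + k)                            ≡⟨ sumFrom-+ g s (suc j) k ⟩
    sumFrom g s (suc j) + sumFrom g (s + suc j) k      ≡⟨ cong (λ t → sumFrom g s (suc j) + sumFrom g t k) (+-suc s j) ⟩
    sumFrom g s (suc j) + sumFrom g (suc (s + j)) k    ∎
    where open ≡-Reasoning

  Φ-split-at-j : ∀ h → sumFrom h s (suc m) ≡ sumFrom h s j + sumFrom h (s + j) (suc k)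
  Φ-split-at-j h = trans (cong (sumFrom h s) split) (sumFrom-+ h s j (suc k))

  drop-prefix : 3 * sumFrom g (suc (s + j)) k ≤ 2 * sumFrom g s (suc m)
  drop-prefix = subst (λ Φ → 3 * Y ≤ 2 * Φ) (sym Φ-split-after-j)
    (dropping-heavy-prefix P Y (subst (_≤ 3 * P) Φ-split-after-j Φ≤3P))
    where
    P = sumFrom g s (suc j)
    Y = sumFrom g (suc (s + j)) k

  halve-suffix : ∀ h → (∀ a → s + j ≤ a → 2 * h a ≤ g a) →
                 3 * (sumFrom g s j + sumFrom h (s + j) (suc k)) ≤ 2 * sumFrom g s (suc m)
  halve-suffix h 2h≤g = subst (λ Φ → 3 * (P + R′) ≤ 2 * Φ) (sym (Φ-split-at-j g))
    (halving-heavy-suffix P _ R′ (subst (3 * P ≤_) (Φ-split-at-j g) 3P≤Φ) (*-sumFrom-≤ 2 {h = h} (s + j) (suc k) 2h≤g))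
    where
    P  = sumFrom g s j
    R′ = sumFrom h (s + j) (suc k)

bump : (ℕ → ℕ) → ℕ → ℕ → ℕ
bump f x a with x ≤? a
... | yes _ = suc (f a)
... | no  _ = f a

bump-≥ : ∀ f {x a} → x ≤ a → bump f x a ≡ suc (f a)
bump-≥ f {x} {a} x≤a with x ≤? a
... | yes _   = refl
... | no  x≰a = ⊥-elim (x≰a x≤a)

bump-< : ∀ f {x a} → a < x → bump f x a ≡ f a
bump-< f {x} {a} a<x with x ≤? a
... | yes x≤a = ⊥-elim (<⇒≱ a<x x≤a)
... | no  _   = refl

Affordable : ℕ → ℕ → Set
Affordable q Φ = Φ * 2 ^ q < 3 ^ q

affordable-step : ∀ q {P P′} → 3 * P′ ≤ 2 * P → Affordable (suc q) P → Affordable q P′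
affordable-step q {P} {P′} 3P′≤2P P-affordable = *-cancelˡ-< 3 _ _ (begin-strict
  3 * (P′ * 2 ^ q)  ≡⟨ sym (*-assoc 3 P′ (2 ^ q)) ⟩
  (3 * P′) * 2 ^ q  ≤⟨ *-monoˡ-≤ (2 ^ q) 3P′≤2P ⟩
  (2 * P) * 2 ^ q   ≡⟨ regroup P (2 ^ q) ⟩
  P * (2 * 2 ^ q)   <⟨ P-affordable ⟩
  3 * 3 ^ q         ∎)
  where
  open ≤-Reasoning
  regroup : ∀ P X → (2 * P) * X ≡ P * (2 * X)
  regroup = solve-∀

affordable-zero : ∀ {Φ} → Affordable 0 Φ → Φ ≡ 0
affordable-zero {Φ} Φ-affordable = n<1⇒n≡0 (subst (_< 1) (*-identityʳ Φ) Φ-affordable)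

module Search (N L : ℕ) where

  potential : ℕ → (ℕ → ℕ) → ℕ
  potential lo f = sumFrom (weight L ∘ f) (suc lo) (N ∸ lo)

  record BalancedQuestion (lo : ℕ) (f : ℕ → ℕ) : Set where
    field
      x           : ℕ
      x≤N         : x ≤ N
      yes-shrinks : 3 * potential x f ≤ 2 * potential lo f
      no-shrinks  : 3 * potential lo (bump f x) ≤ 2 * potential lo f

  balanced-question : ∀ lo f → BalancedQuestion lo f
  balanced-question lo f with N ∸ lo in N∸lo≡
  ... | zero = record { x = N ; x≤N = ≤-refl ; yes-shrinks = yes-shrinks ; no-shrinks = no-shrinks }
    where
    yes-shrinks : 3 * potential N f ≤ 2 * potential lo f
    yes-shrinks rewrite n∸n≡0 N = z≤n
    no-shrinks : 3 * potential lo (bump f N) ≤ 2 * potential lo f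
    no-shrinks rewrite N∸lo≡ = z≤n
  ... | suc m = record { x = x ; x≤N = x≤N ; yes-shrinks = yes-shrinks ; no-shrinks = no-shrinks }
    where
    g = weight L ∘ f
    open TwoThirdsCut (two-thirds-cut g (suc lo) m)
    x = suc lo + j

    N≡x+k : N ≡ x + k
    N≡x+k = begin
      N                 ≡⟨ sym (m+[n∸m]≡n {lo} (<⇒≤ (m∸n≢0⇒n<m (λ N∸lo≡0 → 0≢1+n (trans (sym N∸lo≡0) N∸lo≡))))) ⟩
      lo + (N ∸ lo)     ≡⟨ cong (lo +_) (trans N∸lo≡ split) ⟩
      lo + (j + suc k)  ≡⟨ regroup lo j k ⟩
      suc lo + j + k    ∎
      where
      open ≡-Reasoning
      regroup : ∀ lo j k → lo + (j + suc k) ≡ suc lo + j + k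
      regroup = solve-∀

    x≤N : x ≤ N
    x≤N = subst (x ≤_) (sym N≡x+k) (m≤m+n x k)

    yes-shrinks : 3 * potential x f ≤ 2 * potential lo f
    yes-shrinks rewrite trans (cong (_∸ x) N≡x+k) (m+n∸m≡n x k) | N∸lo≡ = drop-prefix

    g′ = weight L ∘ bump f x

    potential-after-no : sumFrom g′ (suc lo) (suc m) ≡ sumFrom g (suc lo) j + sumFrom g′ x (suc k)
    potential-after-no = begin
      sumFrom g′ (suc lo) (suc m)                          ≡⟨ cong (sumFrom g′ (suc lo)) split ⟩
      sumFrom g′ (suc lo) (j + suc k)                      ≡⟨ sumFrom-+ g′ (suc lo) j (suc k) ⟩
      sumFrom g′ (suc lo) j + sumFrom g′ x (suc k)         ≡⟨ cong (_+ sumFrom g′ x (suc k)) (sumFrom-cong (suc lo) j unchanged) ⟩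
      sumFrom g (suc lo) j + sumFrom g′ x (suc k)          ∎
      where
      open ≡-Reasoning
      unchanged : ∀ a → a < x → g′ a ≡ g a
      unchanged a a<x = cong (weight L) (bump-< f a<x)

    halved : ∀ a → x ≤ a → 2 * g′ a ≤ g a
    halved a x≤a rewrite bump-≥ f x≤a = weight-halves L (f a)

    no-shrinks : 3 * potential lo (bump f x) ≤ 2 * potential lo f
    no-shrinks rewrite N∸lo≡ | potential-after-no = halve-suffix g′ halved

  mutual
    strategy : ∀ q → ℕ → (ℕ → ℕ) → Strategy N q
    strategy zero    lo f = answer lo
    strategy (suc q) lo f = ask x x≤N (next q lo f)
      where open BalancedQuestion (balanced-question lo f)

    next : ∀ q → ℕ → (ℕ → ℕ) → Bool → Strategy N q
    next q lo f true  = strategy q (BalancedQuestion.x (balanced-question lo f)) f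
    next q lo f false = strategy q lo (bump f (BalancedQuestion.x (balanced-question lo f)))

  exhausted : ∀ {lo f A} → potential lo f ≡ 0 → A ≤ N → f A ≤ L → A ≤ lo
  exhausted {lo} {f} {A} Φ≡0 A≤N fA≤L with A ≤? lo
  ... | yes A≤lo = A≤lo
  ... | no  A≰lo = ⊥-elim (<⇒≱ (weight-pos L (f A) fA≤L) (begin
    weight L (f A)                       ≡⟨ cong (weight L ∘ f) (sym (m+[n∸m]≡n lo<A)) ⟩
    weight L (f (suc lo + i))            ≤⟨ term≤sumFrom (weight L ∘ f) (suc lo) i i<N∸lo ⟩
    potential lo f                       ≡⟨ Φ≡0 ⟩
    0                                    ∎))
    where
    open ≤-Reasoning
    lo<A = ≰⇒> A≰lo
    i = A ∸ suc lo
    i<N∸lo : i < N ∸ lo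
    i<N∸lo = begin
      suc i               ≡⟨ sym (m+n∸m≡n lo (suc i)) ⟩
      (lo + suc i) ∸ lo   ≤⟨ ∸-monoˡ-≤ lo (subst (_≤ N) (sym (trans (+-suc lo i) (m+[n∸m]≡n lo<A))) A≤N) ⟩
      N ∸ lo              ∎

  wins : ∀ q lo f {A B L′} → A ≤ B → B ≤ N → lo ≤ B → f A + L′ ≤ L →
         Affordable q (potential lo f) → Wins A B L′ (strategy q lo f)
  wins zero lo f {A} A≤B B≤N lo≤B budget affordable =
    exhausted (affordable-zero affordable) (≤-trans A≤B B≤N) (m+n≤o⇒m≤o (f A) budget) , lo≤B
  wins (suc q) lo f {A} {B} {L′} A≤B B≤N lo≤B budget affordable = respond
    where
    open BalancedQuestion (balanced-question lo f)

    after-yes : x ≤ B → Wins A B L′ (strategy q x f)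
    after-yes x≤B = wins q x f A≤B B≤N x≤B budget (affordable-step q {potential lo f} {potential x f} yes-shrinks affordable)

    after-no : ∀ {L″} → bump f x A + L″ ≤ L → Wins A B L″ (strategy q lo (bump f x))
    after-no budget′ = wins q lo (bump f x) A≤B B≤N lo≤B budget′ (affordable-step q {potential lo f} {potential lo (bump f x)} no-shrinks affordable)

    after-truthful-no : A < x → Wins A B L′ (strategy q lo (bump f x))
    after-truthful-no A<x = after-no (subst (λ e → e + L′ ≤ L) (sym (bump-< f A<x)) budget)

    after-lie : x ≤ A → 1 ≤ L′ → Wins A B (L′ ∸ 1) (strategy q lo (bump f x))
    after-lie x≤A 1≤L′ = after-no (begin
      bump f x A + (L′ ∸ 1)   ≡⟨ cong (_+ (L′ ∸ 1)) (bump-≥ f x≤A) ⟩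
      suc (f A + (L′ ∸ 1))    ≡⟨ sym (+-suc (f A) (L′ ∸ 1)) ⟩
      f A + (1 + (L′ ∸ 1))    ≡⟨ cong (f A +_) (m+[n∸m]≡n 1≤L′) ⟩
      f A + L′                ≤⟨ budget ⟩
      L                       ∎)
      where open ≤-Reasoning

    respond : ∀ b c → Allowed A B x b c → c ≤ L′ → Wins A B (L′ ∸ c) (next q lo f b)
    respond .true  .0 (truthful x≤A)       _    = after-yes (≤-trans x≤A A≤B)
    respond .false .1 (lie x≤A)            1≤L′ = after-lie x≤A 1≤L′
    respond .true  .0 (middle _ x≤B true)  _    = after-yes x≤B
    respond .false .0 (middle A<x _ false) _    = after-truthful-no A<x
    respond .false .0 (above B<x)          _    = after-truthful-no (≤-<-trans A≤B B<x)

[m*n]^k≡m^k*n^k : ∀ m n k → (m * n) ^ k ≡ m ^ k * n ^ k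
[m*n]^k≡m^k*n^k m n zero    = refl
[m*n]^k≡m^k*n^k m n (suc k) = trans (cong (m * n *_) ([m*n]^k≡m^k*n^k m n k)) (regroup m n (m ^ k) (n ^ k))
  where
  regroup : ∀ m n x y → m * n * (x * y) ≡ m * x * (n * y)
  regroup = solve-∀

^-cancelʳ-≤ : ∀ m {n o} → 1 < m → m ^ n ≤ m ^ o → n ≤ o
^-cancelʳ-≤ m {n} {o} 1<m mⁿ≤mᵒ with n ≤? o
... | yes n≤o = n≤o
... | no  n≰o = contradiction mⁿ≤mᵒ (<⇒≱ (^-monoʳ-< m 1<m (≰⇒> n≰o)))

^-cancelˡ-≤ : ∀ k .{{_ : NonZero k}} {m n} → m ^ k ≤ n ^ k → m ≤ n
^-cancelˡ-≤ k {m} {n} mᵏ≤nᵏ with m ≤? n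
... | yes m≤n = m≤n
... | no  m≰n = contradiction mᵏ≤nᵏ (<⇒≱ (^-monoˡ-< k (≰⇒> m≰n)))

^-cancelˡ-< : ∀ k {m n} → m ^ k < n ^ k → m < n
^-cancelˡ-< k {m} {n} mᵏ<nᵏ with m <? n
... | yes m<n = m<n
... | no  m≮n = contradiction mᵏ<nᵏ (≤⇒≯ (^-monoˡ-≤ k (≮⇒≥ m≮n)))

affordable-if-square≤ : ∀ {Φ Q} → 0 < Q → Φ ^ 2 ≤ 2 ^ Q → Affordable Q Φ
affordable-if-square≤ {Φ} {Q} 0<Q Φ²≤2^Q = ^-cancelˡ-< 2 (begin-strict
  (Φ * 2 ^ Q) ^ 2            ≡⟨ [m*n]^k≡m^k*n^k Φ (2 ^ Q) 2 ⟩
  Φ ^ 2 * (2 ^ Q) ^ 2        ≤⟨ *-monoˡ-≤ _ Φ²≤2^Q ⟩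
  2 ^ Q * (2 ^ Q) ^ 2        ≡⟨ cong (2 ^ Q *_) (trans (cong (2 ^ Q *_) (*-identityʳ (2 ^ Q))) (sym ([m*n]^k≡m^k*n^k 2 2 Q))) ⟩
  2 ^ Q * 4 ^ Q              ≡⟨ sym ([m*n]^k≡m^k*n^k 2 4 Q) ⟩
  8 ^ Q                      <⟨ ^-monoˡ-< Q {{>-nonZero 0<Q}} (n<1+n 8) ⟩
  9 ^ Q                      ≡⟨ [m*n]^k≡m^k*n^k 3 3 Q ⟩
  3 ^ Q * 3 ^ Q              ≡⟨ cong (3 ^ Q *_) (sym (*-identityʳ (3 ^ Q))) ⟩
  (3 ^ Q) ^ 2                ∎)
  where open ≤-Reasoning

exponent-cancel : ∀ {N a b c c′} .{{_ : NonZero c}} → 2 ≤ N → c′ ≤ c → N ^ (a * c) ≤ 2 ^ (b * c′) → a ≤ b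
exponent-cancel {N} {a} {b} {c} {c′} 2≤N c′≤c Nᵃᶜ≤2ᵇᶜ′ = *-cancelʳ-≤ a b c (begin
  a * c   ≤⟨ ^-cancelʳ-≤ 2 (n<1+n 1) (≤-trans (^-monoˡ-≤ (a * c) 2≤N) Nᵃᶜ≤2ᵇᶜ′) ⟩
  b * c′  ≤⟨ *-monoʳ-≤ b c′≤c ⟩
  b * c   ∎)
  where open ≤-Reasoning

-- Here Q = 8 + R and D = e + 3 * p; the slack is the difference of the two sides at d = D.
polynomial-bound : ∀ R e p d → d ≤ e + 3 * p →
  (8 + R) * (e * e) + 8 * ((p * (8 + R) + d) * (e + 3 * p)) ≤ (8 + R) * (4 * ((e + 3 * p) * (e + 3 * p)))
polynomial-bound R e p d d≤D = begin
  (8 + R) * (e * e) + 8 * ((p * (8 + R) + d) * (e + 3 * p))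
    ≤⟨ +-monoʳ-≤ ((8 + R) * (e * e)) (*-monoʳ-≤ 8 (*-monoˡ-≤ (e + 3 * p) (+-monoʳ-≤ (p * (8 + R)) d≤D))) ⟩
  (8 + R) * (e * e) + 8 * ((p * (8 + R) + (e + 3 * p)) * (e + 3 * p))
    ≤⟨ m≤m+n _ slack ⟩
  (8 + R) * (e * e) + 8 * ((p * (8 + R) + (e + 3 * p)) * (e + 3 * p)) + slack
    ≡⟨ expand R e p ⟩
  (8 + R) * (4 * ((e + 3 * p) * (e + 3 * p)))
    ∎
  where
  open ≤-Reasoning
  slack = (16 + 3 * R) * (e * e) + (80 + 16 * R) * (e * p) + (24 + 12 * R) * (p * p)
  expand : ∀ R e p →
    (8 + R) * (e * e) + 8 * ((p * (8 + R) + (e + 3 * p)) * (e + 3 * p))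
      + ((16 + 3 * R) * (e * e) + (80 + 16 * R) * (e * p) + (24 + 12 * R) * (p * p))
    ≡ (8 + R) * (4 * ((e + 3 * p) * (e + 3 * p)))
  expand = solve-∀

exponent-bound : ∀ {Q D} E L p d → 8 ≤ Q → D ≡ E + 3 * p → d ≤ D → L * D ≤ p * Q + d →
                 Q * (E * E) + L * (8 * (D * D)) ≤ Q * (4 * (D * D))
exponent-bound {Q} {D} E L p d 8≤Q refl d≤D LD≤ with m≤n⇒∃[o]m+o≡n 8≤Q
... | R , refl = begin
  Q * (E * E) + L * (8 * (D * D))     ≡⟨ cong (Q * (E * E) +_) (regroup L D) ⟩
  Q * (E * E) + 8 * ((L * D) * D)     ≤⟨ +-monoʳ-≤ (Q * (E * E)) (*-monoʳ-≤ 8 (*-monoˡ-≤ D LD≤)) ⟩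
  Q * (E * E) + 8 * ((p * Q + d) * D) ≤⟨ polynomial-bound R E p d d≤D ⟩
  Q * (4 * (D * D))                   ∎
  where
  open ≤-Reasoning
  regroup : ∀ L D → L * (8 * (D * D)) ≡ 8 * ((L * D) * D)
  regroup = solve-∀

square-bound : ∀ N L Q d E → N ^ (8 * (suc d * suc d)) ≤ 2 ^ (Q * (E * E)) →
               Q * (E * E) + L * (8 * (suc d * suc d)) ≤ Q * (4 * (suc d * suc d)) →
               (N * 2 ^ L) ^ 2 ≤ 2 ^ Q
square-bound N L Q d E hyp exponent≤ = ^-cancelˡ-≤ K (begin
  ((N * 2 ^ L) ^ 2) ^ K             ≡⟨ ^-*-assoc (N * 2 ^ L) 2 K ⟩
  (N * 2 ^ L) ^ (2 * K)             ≡⟨ cong ((N * 2 ^ L) ^_) (regroup (suc d)) ⟩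
  (N * 2 ^ L) ^ M                   ≡⟨ [m*n]^k≡m^k*n^k N (2 ^ L) M ⟩
  N ^ M * (2 ^ L) ^ M               ≡⟨ cong (N ^ M *_) (^-*-assoc 2 L M) ⟩
  N ^ M * 2 ^ (L * M)               ≤⟨ *-monoˡ-≤ (2 ^ (L * M)) hyp ⟩
  2 ^ (Q * (E * E)) * 2 ^ (L * M)   ≡⟨ sym (^-distribˡ-+-* 2 (Q * (E * E)) (L * M)) ⟩
  2 ^ (Q * (E * E) + L * M)         ≤⟨ ^-monoʳ-≤ 2 exponent≤ ⟩
  2 ^ (Q * K)                       ≡⟨ sym (^-*-assoc 2 Q K) ⟩
  (2 ^ Q) ^ K                       ∎)
  where
  open ≤-Reasoning
  K = 4 * (suc d * suc d)
  M = 8 * (suc d * suc d)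
  regroup : ∀ D → 2 * (4 * (D * D)) ≡ 8 * (D * D)
  regroup = solve-∀

initial-potential-affordable : ∀ p d → 3 * p < suc d → ∀ {N} → 2 ≤ N → ∀ Q →
  N ^ (8 * (suc d * suc d)) ≤ 2 ^ (Q * ((suc d ∸ 3 * p) * (suc d ∸ 3 * p))) →
  Affordable Q (N * 2 ^ ⌈ p * Q /suc d ⌉)
initial-potential-affordable p d 3p<D {N} 2≤N Q hyp =
  affordable-if-square≤ {N * 2 ^ L} (≤-trans (s≤s z≤n) 8≤Q) (square-bound N L Q d E hyp exponent≤)
  where
  L = ⌈ p * Q /suc d ⌉
  E = suc d ∸ 3 * p
  E≤D : E ≤ suc d
  E≤D = m∸n≤m (suc d) (3 * p)
  8≤Q : 8 ≤ Q
  8≤Q = exponent-cancel {N} {8} {Q} 2≤N (*-mono-≤ E≤D E≤D) hyp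
  D≡E+3p : suc d ≡ E + 3 * p
  D≡E+3p = sym (m∸n+n≡m (<⇒≤ 3p<D))
  exponent≤ : Q * (E * E) + L * (8 * (suc d * suc d)) ≤ Q * (4 * (suc d * suc d))
  exponent≤ = exponent-bound E L p d 8≤Q D≡E+3p (n≤1+n d) (m/n*n≤m (p * Q + d) (suc d))

corollary7 : (p d : ℕ) → 3 * p < suc d → (N : ℕ) → 2 ≤ N → (Q : ℕ)
    → N ^ (8 * (suc d * suc d)) ≤ 2 ^ (Q * ((suc d ∸ 3 * p) * (suc d ∸ 3 * p)))
    → Σ (Strategy N Q) (λ S → (A B : ℕ) → A ≤ B → B ≤ N → Wins A B ⌈ p * Q /suc d ⌉ S)
corollary7 p d 3p<D N 2≤N Q hyp =
  strategy Q 0 no-answers , λ A B A≤B B≤N → wins Q 0 no-answers A≤B B≤N z≤n ≤-refl affordable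
  where
  L = ⌈ p * Q /suc d ⌉
  open Search N L
  no-answers : ℕ → ℕ
  no-answers _ = 0
  initial-potential : potential 0 no-answers ≡ N * 2 ^ L
  initial-potential = trans (sumFrom-const (weight L 0) 1 N) (cong (N *_) (weight-zero L))
  affordable : Affordable Q (potential 0 no-answers)
  affordable = subst (Affordable Q) (sym initial-potential) (initial-potential-affordable p d 3p<D 2≤N Q hyp)
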